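{- Run the colouring procedure (described in the context) on an Eulerian directed multigraph $G=(V,E)$. At every step of the execution, a backtracking step occurs from the current vertex $u$ only when $u$ is a needle vertex.
   Context: $G=(V,E)$ is a finite directed multigraph (loops and parallel edges allowed), Eulerian: strongly connected and every vertex has in-degree equal to out-degree. For a vertex $v$ and colour $X$, $d^+(v,X)$ (resp. $d^-(v,X)$) is the number of edges leaving (resp. entering) $v$ currently coloured $X$. Colouring procedure: each edge has a colour in $\{\textsc{Black},\textsc{Red},\textsc{Green},\textsc{Dashed}\}$, initially all \textsc{Black}. Choose a start vertex $v_0$; the current vertex is $u=v_0$, and $v_0$ is marked reached. Repeat: if some \textsc{Black} edge $wu$ enters the current vertex $u$, pick one, colour it \textsc{Red} if $w$ was not yet reached (and mark $w$ reached), otherwise \textsc{Green}, and make $w$ current (forward step). Otherwise: if some \textsc{Green} edge $uw$ leaves $u$, colour it \textsc{Dashed}, output it, make $w$ current; else if $u\ne v_0$, colour the unique \textsc{Red} edge $uw$ leaving $u$ \textsc{Dashed}, output it, make $w$ current (these two are backtracking steps); else terminate. Needle vertex: with $u$ the current vertex, a vertex $w$ is a needle vertex iff either $w=u$ and $d^+(w,\textsc{Black})=d^-(w,\textsc{Black})$, or $w\ne u$ and $d^+(w,\textsc{Black})=d^-(w,\textsc{Black})+1$. -}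

module Defs where

open import Data.Nat using (ℕ; suc; _+_)
open import Data.Fin using (Fin; _≟_)
open import Data.Fin.Base using ()
open import Data.List using (List; length; filter)
open import Data.List.Base using (allFin)
open import Data.Bool using (Bool; true; false)
open import Data.Product using (Σ; ∃; _×_; _,_)
open import Data.Sum using (_⊎_)
open import Relation.Nullary using (¬_; Dec; yes; no)
open import Relation.Nullary.Decidable using (_×-dec_)
open import Relation.Binary.PropositionalEquality using (_≡_; _≢_)
open import Relation.Binary.Construct.Closure.ReflexiveTransitive using (Star)

record Multigraph : Set where
  field
    n   : ℕ
    m   : ℕ
    src : Fin m → Fin n
    tgt : Fin m → Fin n
open Multigraph public

module _ (G : Multigraph) where

  Adj : Fin (n G) → Fin (n G) → Set
  Adj v w = Σ (Fin (m G)) λ e → src G e ≡ v × tgt G e ≡ w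

  StronglyConnected : Set
  StronglyConnected = ∀ v w → Star Adj v w

  outdeg indeg : Fin (n G) → ℕ
  outdeg v = length (filter (λ e → src G e ≟ v) (allFin (m G)))
  indeg  v = length (filter (λ e → tgt G e ≟ v) (allFin (m G)))

  Eulerian : Set
  Eulerian = StronglyConnected × (∀ v → outdeg v ≡ indeg v)

data Colour : Set where
  Black Red Green Dashed : Colour

_≟c_ : (x y : Colour) → Dec (x ≡ y)
Black  ≟c Black  = yes _≡_.refl
Red    ≟c Red    = yes _≡_.refl
Green  ≟c Green  = yes _≡_.refl
Dashed ≟c Dashed = yes _≡_.refl
Black  ≟c Red    = no λ ()
Black  ≟c Green  = no λ ()
Black  ≟c Dashed = no λ ()
Red    ≟c Black  = no λ ()
Red    ≟c Green  = no λ ()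
Red    ≟c Dashed = no λ ()
Green  ≟c Black  = no λ ()
Green  ≟c Red    = no λ ()
Green  ≟c Dashed = no λ ()
Dashed ≟c Black  = no λ ()
Dashed ≟c Red    = no λ ()
Dashed ≟c Green  = no λ ()

module Procedure (G : Multigraph) (v₀ : Fin (n G)) where

  V E : Set
  V = Fin (n G)
  E = Fin (m G)

  record State : Set where
    constructor ⟨_,_,_⟩
    field
      colour  : E → Colour
      reached : V → Bool
      current : V
  open State public

  initial : State
  initial = ⟨ (λ _ → Black) , (λ v → reached₀ v) , v₀ ⟩
    where
    reached₀ : V → Bool
    reached₀ v with v ≟ v₀
    ... | yes _ = true
    ... | no  _ = false

  recolour : (E → Colour) → E → Colour → E → Colour
  recolour c e X e' with e' ≟ e
  ... | yes _ = X
  ... | no  _ = c e'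

  mark : (V → Bool) → V → V → Bool
  mark r w v with v ≟ w
  ... | yes _ = true
  ... | no  _ = r v

  d⁺ d⁻ : State → V → Colour → ℕ
  d⁺ s v X = length (filter (λ e → (src G e ≟ v) ×-dec (colour s e ≟c X)) (allFin (m G)))
  d⁻ s v X = length (filter (λ e → (tgt G e ≟ v) ×-dec (colour s e ≟c X)) (allFin (m G)))

  NoBlackIn : State → Set
  NoBlackIn s = ∀ e → tgt G e ≡ current s → colour s e ≢ Black

  data ForwardStep : State → State → Set where
    fwd-red : ∀ {s} e → tgt G e ≡ current s → colour s e ≡ Black →
              reached s (src G e) ≡ false →
              ForwardStep s ⟨ recolour (colour s) e Red , mark (reached s) (src G e) , src G e ⟩
    fwd-green : ∀ {s} e → tgt G e ≡ current s → colour s e ≡ Black →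
              reached s (src G e) ≡ true →
              ForwardStep s ⟨ recolour (colour s) e Green , reached s , src G e ⟩

  -- backtracking steps (the dashed edge is the output edge)
  data BacktrackStep : State → State → Set where
    back-green : ∀ {s} e → NoBlackIn s → src G e ≡ current s → colour s e ≡ Green →
              BacktrackStep s ⟨ recolour (colour s) e Dashed , reached s , tgt G e ⟩
    back-red : ∀ {s} e → NoBlackIn s →
              (∀ e' → src G e' ≡ current s → colour s e' ≢ Green) →
              current s ≢ v₀ → src G e ≡ current s → colour s e ≡ Red →
              BacktrackStep s ⟨ recolour (colour s) e Dashed , reached s , tgt G e ⟩

  Step : State → State → Set
  Step s t = ForwardStep s t ⊎ BacktrackStep s t

  Reachable : State → Set
  Reachable s = Star Step initial s

  Needle : State → V → Set
  Needle s w = (w ≡ current s × d⁺ s w Black ≡ d⁻ s w Black)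
             ⊎ (w ≢ current s × d⁺ s w Black ≡ suc (d⁻ s w Black))

-- Since G is Eulerian, the Black edges start out balanced at every vertex.  The forward
-- steps taken since the last backtracking step traverse, against their direction, a trail
-- of edges taken out of Black that runs from the current vertex u to the vertex x where
-- this phase began, so the Black degrees satisfy d⁺(w) + [w = u] = d⁻(w) + [w = x] at
-- every vertex w; backtracking only recolours non-Black edges.  A backtracking step needs
-- d⁻(u) = 0, which forces u = x, so at that moment every vertex, u in particular, is balanced.
module Submission where

open import Defs
open import Algebra.Properties.CommutativeSemigroup using (xy∙z≈xz∙y)
open import Data.Fin using (Fin; _≟_)
open import Data.List using (List; _∷_; length; filter; allFin)
open import Data.List.Membership.Propositional using (_∈_)
open import Data.List.Membership.Propositional.Properties using (∈-allFin)
open import Data.List.Properties using (filter-none)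
open import Data.List.Relation.Unary.All as All using (All; []; _∷_)
open import Data.List.Relation.Unary.AllPairs using (_∷_)
open import Data.List.Relation.Unary.Any using (here; there)
open import Data.List.Relation.Unary.Unique.Propositional using (Unique)
open import Data.List.Relation.Unary.Unique.Propositional.Properties using (allFin⁺)
open import Data.Nat using (ℕ; _+_)
open import Data.Nat.Properties
  using (+-assoc; +-comm; +-identityʳ; +-cancelʳ-≡; m+1+n≢0; +-commutativeSemigroup)
open import Data.Product using (∃; _×_; _,_; proj₁; proj₂)
open import Data.Sum using (inj₁; inj₂)
open import Function.Base using (id; _∘_)
open import Function.Bundles using (_⇔_; mk⇔; Equivalence)
open import Level using (Level)
open import Relation.Binary.Construct.Closure.ReflexiveTransitive using (Star; ε; _◅_)
open import Relation.Binary.PropositionalEquality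
open import Relation.Nullary using (¬_; Dec; yes; no; contradiction)
open import Relation.Nullary.Decidable using (_×-dec_)
open import Relation.Unary using (Pred; Decidable)

private variable
  a b p q : Level
  A : Set a
  B : Set b

𝟙 : Dec A → ℕ
𝟙 (yes _) = 1
𝟙 (no _)  = 0

𝟙-yes : A → (a? : Dec A) → 𝟙 a? ≡ 1
𝟙-yes x (yes _) = refl
𝟙-yes x (no ¬x) = contradiction x ¬x

𝟙-no : ¬ A → (a? : Dec A) → 𝟙 a? ≡ 0
𝟙-no ¬x (yes x) = contradiction x ¬x
𝟙-no ¬x (no _)  = refl

𝟙-cong : A ⇔ B → (a? : Dec A) (b? : Dec B) → 𝟙 a? ≡ 𝟙 b?
𝟙-cong A⇔B a? (yes y) = 𝟙-yes (Equivalence.from A⇔B y) a?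
𝟙-cong A⇔B a? (no ¬y) = 𝟙-no (¬y ∘ Equivalence.to A⇔B) a?

count : {P : Pred A p} → Decidable P → List A → ℕ
count P? xs = length (filter P? xs)

count-∷ : {P : Pred A p} (P? : Decidable P) → ∀ x xs → count P? (x ∷ xs) ≡ 𝟙 (P? x) + count P? xs
count-∷ P? x xs with P? x
... | yes _ = refl
... | no _  = refl

module _ {P : Pred A p} {Q : Pred A q} (P? : Decidable P) (Q? : Decidable Q) where
  open ≡-Reasoning

  count-cong : ∀ {xs} → All (λ x → P x ⇔ Q x) xs → count P? xs ≡ count Q? xs
  count-cong {_}      []                = refl
  count-cong {x ∷ xs} (Px⇔Qx ∷ P⇔Q) = begin
    count P? (x ∷ xs)          ≡⟨ count-∷ P? x xs ⟩
    𝟙 (P? x) + count P? xs     ≡⟨ cong₂ _+_ (𝟙-cong Px⇔Qx (P? x) (Q? x)) (count-cong P⇔Q) ⟩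
    𝟙 (Q? x) + count Q? xs     ≡⟨ count-∷ Q? x xs ⟨
    count Q? (x ∷ xs)          ∎

  count-differ-at : ∀ {e xs} → Unique xs → e ∈ xs →
                    (∀ {x} → e ≢ x → P x ⇔ Q x) → ¬ Q e →
                    count P? xs ≡ count Q? xs + 𝟙 (P? e)
  count-differ-at {e} {_ ∷ xs} (e∉xs ∷ _) (here refl) P⇔Q ¬Qe = begin
    count P? (e ∷ xs)                 ≡⟨ count-∷ P? e xs ⟩
    𝟙 (P? e) + count P? xs            ≡⟨ +-comm (𝟙 (P? e)) _ ⟩
    count P? xs + 𝟙 (P? e)            ≡⟨ cong (_+ 𝟙 (P? e)) (count-cong (All.map P⇔Q e∉xs)) ⟩
    count Q? xs + 𝟙 (P? e)            ≡⟨ cong (λ k → k + count Q? xs + 𝟙 (P? e)) (𝟙-no ¬Qe (Q? e)) ⟨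
    𝟙 (Q? e) + count Q? xs + 𝟙 (P? e) ≡⟨ cong (_+ 𝟙 (P? e)) (count-∷ Q? e xs) ⟨
    count Q? (e ∷ xs) + 𝟙 (P? e)      ∎
  count-differ-at {e} {x ∷ xs} (x∉xs ∷ xs!) (there e∈xs) P⇔Q ¬Qe = begin
    count P? (x ∷ xs)                   ≡⟨ count-∷ P? x xs ⟩
    𝟙 (P? x) + count P? xs              ≡⟨ cong₂ _+_ Px≡Qx (count-differ-at xs! e∈xs P⇔Q ¬Qe) ⟩
    𝟙 (Q? x) + (count Q? xs + 𝟙 (P? e)) ≡⟨ +-assoc (𝟙 (Q? x)) _ _ ⟨
    𝟙 (Q? x) + count Q? xs + 𝟙 (P? e)   ≡⟨ cong (_+ 𝟙 (P? e)) (count-∷ Q? x xs) ⟨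
    count Q? (x ∷ xs) + 𝟙 (P? e)        ∎
    where
    Px≡Qx : 𝟙 (P? x) ≡ 𝟙 (Q? x)
    Px≡Qx = 𝟙-cong (P⇔Q (≢-sym (All.lookup x∉xs e∈xs))) (P? x) (Q? x)

module _ (G : Multigraph) (v₀ : Fin (n G)) where
  open Procedure G v₀
  open ≡-Reasoning

  degree : (E → V) → (E → Colour) → V → Colour → ℕ
  degree end c v X = count (λ e → (end e ≟ v) ×-dec (c e ≟c X)) (allFin (m G))

  recolour-same : ∀ c e X → recolour c e X e ≡ X
  recolour-same c e X with e ≟ e
  ... | yes _  = refl
  ... | no e≢e = contradiction refl e≢e

  recolour-other : ∀ c e X {e′} → e ≢ e′ → recolour c e X e′ ≡ c e′
  recolour-other c e X {e′} e≢e′ with e′ ≟ e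
  ... | yes e′≡e = contradiction (sym e′≡e) e≢e′
  ... | no _     = refl

  degree-recolour : ∀ end c e {Y} v X → Y ≢ X →
                    degree end c v X
                      ≡ degree end (recolour c e Y) v X + 𝟙 ((end e ≟ v) ×-dec (c e ≟c X))
  degree-recolour end c e {Y} v X Y≢X =
    count-differ-at _ _ (allFin⁺ (m G)) (∈-allFin e) agree-off-e
      (λ (_ , Ye≡X) → Y≢X (trans (sym (recolour-same c e Y)) Ye≡X))
    where
    agree-off-e : ∀ {e′} → e ≢ e′ → (end e′ ≡ v × c e′ ≡ X) ⇔ (end e′ ≡ v × recolour c e Y e′ ≡ X)
    agree-off-e e≢e′ rewrite recolour-other c e Y e≢e′ = mk⇔ id id

  degree-recolour-away : ∀ end {c e Y} v {X} → c e ≡ X → Y ≢ X →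
                         degree end c v X ≡ degree end (recolour c e Y) v X + 𝟙 (v ≟ end e)
  degree-recolour-away end {c} {e} {Y} v {X} ce≡X Y≢X =
    trans (degree-recolour end c e v X Y≢X)
          (cong (degree end (recolour c e Y) v X +_) (𝟙-cong at-e _ _))
    where
    at-e : (end e ≡ v × c e ≡ X) ⇔ (v ≡ end e)
    at-e = mk⇔ (λ (ee≡v , _) → sym ee≡v) (λ v≡ee → sym v≡ee , ce≡X)

  degree-recolour-outside : ∀ end {c e Y} v {X} → c e ≢ X → Y ≢ X →
                            degree end c v X ≡ degree end (recolour c e Y) v X
  degree-recolour-outside end {c} {e} {Y} v {X} ce≢X Y≢X = begin
    degree end c v X                                      ≡⟨ degree-recolour end c e v X Y≢X ⟩
    degree end c′ v X + 𝟙 ((end e ≟ v) ×-dec (c e ≟c X)) ≡⟨ cong (degree end c′ v X +_) (𝟙-no (ce≢X ∘ proj₂) _) ⟩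
    degree end c′ v X + 0                                 ≡⟨ +-identityʳ _ ⟩
    degree end c′ v X                                     ∎
    where
    c′ : E → Colour
    c′ = recolour c e Y

  degree-monochrome : ∀ end v X → degree end (λ _ → X) v X ≡ count (λ e → end e ≟ v) (allFin (m G))
  degree-monochrome end v X = count-cong _ _ (All.universal (λ _ → mk⇔ proj₁ (_, refl)) (allFin (m G)))

  Balanced : (E → Colour) → Set
  Balanced c = ∀ w → degree (src G) c w Black ≡ degree (tgt G) c w Black

  TrailBalanced : (E → Colour) → V → V → Set
  TrailBalanced c u x =
    ∀ w → degree (src G) c w Black + 𝟙 (w ≟ u) ≡ degree (tgt G) c w Black + 𝟙 (w ≟ x)

  balanced⇒trailBalanced : ∀ {c} u → Balanced c → TrailBalanced c u u
  balanced⇒trailBalanced u bal w = cong (_+ 𝟙 (w ≟ u)) (bal w)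

  trailBalanced⇒balanced : ∀ {c u} → TrailBalanced c u u → Balanced c
  trailBalanced⇒balanced {u = u} tb w = +-cancelʳ-≡ (𝟙 (w ≟ u)) _ _ (tb w)

  recolour-balanced : ∀ {c e Y} → c e ≢ Black → Y ≢ Black → Balanced c → Balanced (recolour c e Y)
  recolour-balanced {c} {e} {Y} ce≢B Y≢B bal w = begin
    degree (src G) (recolour c e Y) w Black ≡⟨ degree-recolour-outside (src G) w ce≢B Y≢B ⟨
    degree (src G) c w Black                ≡⟨ bal w ⟩
    degree (tgt G) c w Black                ≡⟨ degree-recolour-outside (tgt G) w ce≢B Y≢B ⟩
    degree (tgt G) (recolour c e Y) w Black ∎

  trailBalanced-extend : ∀ {c e Y u x} → tgt G e ≡ u → c e ≡ Black → Y ≢ Black →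
                         TrailBalanced c u x → TrailBalanced (recolour c e Y) (src G e) x
  trailBalanced-extend {c} {e} {Y} {x = x} refl ce≡B Y≢B tb w = +-cancelʳ-≡ [w=u] _ _ (begin
    out′ + [w=src] + [w=u]               ≡⟨ cong (_+ [w=u]) (degree-recolour-away (src G) w ce≡B Y≢B) ⟨
    degree (src G) c w Black + [w=u]     ≡⟨ tb w ⟩
    degree (tgt G) c w Black + 𝟙 (w ≟ x) ≡⟨ cong (_+ 𝟙 (w ≟ x)) (degree-recolour-away (tgt G) w ce≡B Y≢B) ⟩
    in′ + [w=u] + 𝟙 (w ≟ x)              ≡⟨ xy∙z≈xz∙y +-commutativeSemigroup in′ _ _ ⟩
    in′ + 𝟙 (w ≟ x) + [w=u]              ∎)
    where
    out′ in′ [w=src] [w=u] : ℕ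
    out′    = degree (src G) (recolour c e Y) w Black
    in′     = degree (tgt G) (recolour c e Y) w Black
    [w=src] = 𝟙 (w ≟ src G e)
    [w=u]   = 𝟙 (w ≟ tgt G e)

  trailBalanced-end : ∀ {c u x} → TrailBalanced c u x → degree (tgt G) c u Black ≡ 0 → u ≡ x
  trailBalanced-end {c} {u} {x} tb no-in with u ≟ x
  ... | yes u≡x = u≡x
  ... | no u≢x  = contradiction (begin
    out + 1                              ≡⟨ cong (out +_) (𝟙-yes refl (u ≟ u)) ⟨
    out + 𝟙 (u ≟ u)                      ≡⟨ tb u ⟩
    degree (tgt G) c u Black + 𝟙 (u ≟ x) ≡⟨ cong₂ _+_ no-in (𝟙-no u≢x (u ≟ x)) ⟩
    0                                    ∎) (m+1+n≢0 out)
    where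
    out : ℕ
    out = degree (src G) c u Black

  Invariant : State → Set
  Invariant s = ∃ (TrailBalanced (colour s) (current s))

  initial-invariant : (∀ v → outdeg G v ≡ indeg G v) → Invariant initial
  initial-invariant eulerian = v₀ , λ w → cong (_+ 𝟙 (w ≟ v₀)) (begin
    degree (src G) (λ _ → Black) w Black ≡⟨ degree-monochrome (src G) w Black ⟩
    outdeg G w                           ≡⟨ eulerian w ⟩
    indeg G w                            ≡⟨ degree-monochrome (tgt G) w Black ⟨
    degree (tgt G) (λ _ → Black) w Black ∎)

  backtrack-noBlackIn : ∀ {s t} → BacktrackStep s t → NoBlackIn s
  backtrack-noBlackIn (back-green _ noBlackIn _ _)   = noBlackIn
  backtrack-noBlackIn (back-red _ noBlackIn _ _ _ _) = noBlackIn

  noBlackIn⇒d⁻≡0 : ∀ s → NoBlackIn s → d⁻ s (current s) Black ≡ 0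
  noBlackIn⇒d⁻≡0 s noBlackIn = cong length (filter-none _ (All.universal ¬black-in (allFin (m G))))
    where
    ¬black-in : ∀ e → ¬ (tgt G e ≡ current s × colour s e ≡ Black)
    ¬black-in e (e↦u , e-black) = noBlackIn e e↦u e-black

  backtrack-balanced : ∀ {s t} → BacktrackStep s t → Invariant s → Balanced (colour s)
  backtrack-balanced {s} step (x , tb) =
    trailBalanced⇒balanced (subst (TrailBalanced (colour s) (current s)) (sym u≡x) tb)
    where
    u≡x : current s ≡ x
    u≡x = trailBalanced-end tb (noBlackIn⇒d⁻≡0 s (backtrack-noBlackIn step))

  step-invariant : ∀ {s t} → Step s t → Invariant s → Invariant t
  step-invariant (inj₁ (fwd-red _ e↦u e-black _)) (x , tb) =
    x , trailBalanced-extend e↦u e-black (λ ()) tb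
  step-invariant (inj₁ (fwd-green _ e↦u e-black _)) (x , tb) =
    x , trailBalanced-extend e↦u e-black (λ ()) tb
  step-invariant (inj₂ step@(back-green _ _ _ e-green)) inv = _ , balanced⇒trailBalanced _
    (recolour-balanced (subst (_≢ Black) (sym e-green) (λ ())) (λ ()) (backtrack-balanced step inv))
  step-invariant (inj₂ step@(back-red _ _ _ _ _ e-red)) inv = _ , balanced⇒trailBalanced _
    (recolour-balanced (subst (_≢ Black) (sym e-red) (λ ())) (λ ()) (backtrack-balanced step inv))

  star-invariant : ∀ {s t} → Star Step s t → Invariant s → Invariant t
  star-invariant ε            inv = inv
  star-invariant (step ◅ run) inv = star-invariant run (step-invariant step inv)

lemma5 : (G : Multigraph) → Eulerian G → (v₀ : Fin (n G)) →
         let open Procedure G v₀ in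
         ∀ s t → Reachable s → BacktrackStep s t → Needle s (current s)
lemma5 G (_ , eulerian) v₀ s t reachable step = inj₁ (refl , balanced (current s))
  where
  open Procedure G v₀
  balanced : Balanced G v₀ (colour s)
  balanced = backtrack-balanced G v₀ step (star-invariant G v₀ reachable (initial-invariant G v₀ eulerian))
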